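{- Let $K\ge 0$ be an integer. Let $G_1,\ldots,G_n$ be nondeterministic automata, where $G_i$ has set of secret states $Q_i^S$, and consider the composed system $G_1\|\cdots\|G_n$ with interaction $\|_\lor$, i.e. with set of secret states $Q^S=Q\setminus(Q_1^{NS}\times\cdots\times Q_n^{NS})$, $Q_i^{NS}=Q_i\setminus Q_i^S$. For $1\le i\le n$ let $H_i$ be the two-way observer of $G_i$, let $H=H_1\|\cdots\|H_n$ with event set $\Sigma_H$, and let $P_\Delta:\Sigma_H^*\to\Delta_R(\Sigma)^*$ be the natural projection erasing all events not in $\Delta_R(\Sigma)$, where $\Sigma=\Sigma_1\cup\cdots\cup\Sigma_n$. Suppose that for every string $s\in L(H)$ with $H\stackrel{s}{\to}((X^1,X^1_R),\ldots,(X^n,X^n_R))$ the following holds: if there exists $i$ with $X^i\cap X^i_R\subseteq Q_i^S$ and $X^i\cap X^i_R\neq\emptyset$, then $|P_\Delta(s)|>K$. Then $G_1\|\cdots\|G_n$ is $K$-step opaque.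
   Context: An automaton is $G=\langle\Sigma_\tau,Q,\to,Q^\circ\rangle$ with finite set $\Sigma$ of observable events, a special unobservable event $\tau\notin\Sigma$, $\Sigma_\tau=\Sigma\cup\{\tau\}$, finite states $Q$, transitions $\to\subseteq Q\times\Sigma_\tau\times Q$, initial states $Q^\circ$, and secret states $Q^S\subseteq Q$, $Q^{NS}=Q\setminus Q^S$. For $s\in\Sigma^*$, $p\stackrel{s}{\Rightarrow}q$ means there is $t\in\Sigma_\tau^*$ which becomes $s$ after deleting all $\tau$'s and $p\stackrel{t}{\to}q$; $p\stackrel{s}{\Rightarrow}$ means this for some $q$; $L(G,q)=\{s:q\stackrel{s}{\Rightarrow}\}$, $L(G)$ the strings executable from an initial state. Synchronous composition: states are tuples, initial states products of initial states; a shared event (other than $\tau$, never shared) is executed jointly by all components having it in their alphabet; other events are executed by a single component while the others stay put. $K$-step opacity: $G$ is $K$-step opaque w.r.t. $Q^S$ iff for every $q^\circ\in Q^\circ$ and all $s,t\in\Sigma^*$ with $st\in L(G,q^\circ)$, $q^\circ\stackrel{s}{\Rightarrow}Q^S$ and $|t|\le K$, there exist $q'^\circ\in Q^\circ$ and $y\in Q^{NS}$ with $q'^\circ\stackrel{s}{\Rightarrow}y$ and $y\stackrel{t}{\Rightarrow}$. Reversed automaton: $G_R=\langle\Sigma_\tau,Q,\to_R,Q\rangle$ with $(x,\sigma,y)\in\to_R$ iff $y\stackrel{\sigma}{\to}x$, all states initial. Current-state estimator: $UR(B)$ is the set of states reachable from $B$ by strings in $\{\tau\}^*$; $det(G)$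 is the deterministic automaton over $\Sigma$ with initial state $UR(Q^\circ)$ and transitions $X\stackrel{\sigma}{\to}Y$ where $Y=\bigcup\{UR(\{y\}): x\stackrel{\sigma}{\to}y, x\in X\}$ is nonempty; only reachable states are kept. Two-way observer: with renamings $\Delta(\sigma)=(\sigma,\epsilon)$, $\Delta_R(\sigma)=(\epsilon,\sigma)$ relabelling transitions, $H_i=\Delta(det(G_i))\|\Delta_R(det(G_{i,R}))$, a deterministic automaton over $\Delta(\Sigma_i)\cup\Delta_R(\Sigma_i)$ with reachable states $(X^i,X^i_R)$, $X^i,X^i_R\subseteq Q_i$; $H_1\|\cdots\|H_n$ synchronizes on common renamed events. -}

module Defs where

open import Level using (Level) renaming (zero to 0ℓ; suc to lsuc)
open import Data.Nat using (ℕ; zero; suc)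
open import Data.Fin using (Fin; zero; suc)
open import Data.Bool using (Bool; true; false; not)
open import Data.Maybe using (Maybe; just; nothing)
open import Data.List using (List; []; _∷_; _++_; length; catMaybes; replicate; allFin)
open import Data.Bool.ListAction using (all; any)
open import Data.Product using (Σ; _×_; _,_; Σ-syntax)
open import Data.Sum using (_⊎_; inj₁; inj₂)
open import Data.Empty.Polymorphic using (⊥)
open import Relation.Binary.PropositionalEquality using (_≡_; _≢_)

-- Generic (possibly infinite-state) labelled transition systems with
-- an unobservable event τ, encoded as `nothing : Maybe E`.
-- `alph` is the observable alphabet (as a decidable subset of E).

record LTS (ℓ : Level) (E : Set) : Set (lsuc ℓ) where
  field
    State : Set ℓ
    alph  : E → Bool
    trans : State → Maybe E → State → Set ℓ
    init  : State → Set ℓ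

open LTS public

-- Events are drawn from a finite universe Fin e, the
-- alphabet Σ ⊆ Fin e is `alph`, Q = Fin nQ, and →, Q°, Q^S are finite
-- (decidable) sets.

record FinAut (e : ℕ) : Set where
  field
    nQ         : ℕ
    alph       : Fin e → Bool
    trans      : Fin nQ → Maybe (Fin e) → Fin nQ → Bool
    trans-alph : ∀ p σ q → trans p (just σ) q ≡ true → alph σ ≡ true
    init       : Fin nQ → Bool
    secret     : Fin nQ → Bool

toLTS : ∀ {e} → FinAut e → LTS 0ℓ (Fin e)
toLTS G = record
  { State = Fin (FinAut.nQ G)
  ; alph  = FinAut.alph G
  ; trans = λ p a q → FinAut.trans G p a q ≡ true
  ; init  = λ q → FinAut.init G q ≡ true
  }

reverseAut : ∀ {e} → FinAut e → FinAut e
reverseAut G = record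
  { nQ         = FinAut.nQ G
  ; alph       = FinAut.alph G
  ; trans      = λ x a y → FinAut.trans G y a x
  ; trans-alph = λ x σ y h → FinAut.trans-alph G y σ x h
  ; init       = λ _ → true
  ; secret     = FinAut.secret G
  }

data Path {ℓ : Level} {E : Set} (A : LTS ℓ E) :
     State A → List (Maybe E) → State A → Set ℓ where
  []  : ∀ {p} → Path A p [] p
  _∷_ : ∀ {p a q t r} → trans A p a q → Path A q t r → Path A p (a ∷ t) r

erase : ∀ {E : Set} → List (Maybe E) → List E
erase = catMaybes

Weak : ∀ {ℓ E} (A : LTS ℓ E) → State A → List E → State A → Set ℓ
Weak A p s q = Σ[ t ∈ List (Maybe _) ] (erase t ≡ s × Path A p t q)

Can : ∀ {ℓ E} (A : LTS ℓ E) → State A → List E → Set ℓ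
Can A p s = Σ[ q ∈ State A ] Weak A p s q

InitRun : ∀ {ℓ E} (A : LTS ℓ E) → List E → State A → Set ℓ
InitRun A s q = Σ[ h₀ ∈ State A ] (init A h₀ × Weak A h₀ s q)

KStepOpaque : ∀ {ℓ E} (A : LTS ℓ E) → (State A → Bool) → ℕ → Set ℓ
KStepOpaque A secret K =
  ∀ (q₀ : State A) → init A q₀ → ∀ (s t : List _) →
  Can A q₀ (s ++ t) →
  (Σ[ q ∈ State A ] (Weak A q₀ s q × secret q ≡ true)) →
  length t Data.Nat.≤ K →
  Σ[ q₀' ∈ State A ] (init A q₀' ×
    Σ[ y ∈ State A ] (secret y ≡ false × Weak A q₀' s y × Can A y t))

compose : ∀ {ℓ E} (n : ℕ) → (Fin n → LTS ℓ E) → LTS ℓ E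
compose n A = record
  { State = (i : Fin n) → State (A i)
  ; alph  = alphC
  ; trans = tr
  ; init  = λ q → (i : Fin n) → init (A i) (q i)
  }
  where
  alphC : _ → Bool
  alphC σ = any (λ i → alph (A i) σ) (allFin n)
  tr : ((i : Fin n) → State (A i)) → Maybe _ → ((i : Fin n) → State (A i)) → Set _
  tr q nothing  q' = Σ[ i ∈ Fin n ]
    (trans (A i) (q i) nothing (q' i) × (∀ j → j ≢ i → q' j ≡ q j))
  tr q (just σ) q' = alphC σ ≡ true ×
    (∀ i → (alph (A i) σ ≡ true → trans (A i) (q i) (just σ) (q' i))
         × (alph (A i) σ ≡ false → q' i ≡ q i))

-- Current-state estimator det(G) (states = subsets of Q as predicates).

UR : ∀ {E} (A : LTS 0ℓ E) → (State A → Set) → State A → Set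
UR A B y = Σ[ x ∈ State A ] (B x × Σ[ k ∈ ℕ ] Path A x (replicate k nothing) y)

post : ∀ {E} (A : LTS 0ℓ E) → (State A → Set) → E → State A → Set
post A X σ y = Σ[ x ∈ State A ] (X x ×
  Σ[ y' ∈ State A ] (trans A x (just σ) y' × UR A (λ z → z ≡ y') y))

det : ∀ {E} → LTS 0ℓ E → LTS (lsuc 0ℓ) E
det {E} A = record
  { State = State A → Set
  ; alph  = alph A
  ; trans = tr
  ; init  = λ X → X ≡ UR A (init A)
  }
  where
  tr : (State A → Set) → Maybe E → (State A → Set) → Set₁
  tr X nothing  Y = ⊥
  tr X (just σ) Y = alph A σ ≡ true × Y ≡ post A X σ × Σ[ y ∈ State A ] Y y

-- Renamings Δ(σ) = (σ,ε) ↦ inj₁ σ and Δ_R(σ) = (ε,σ) ↦ inj₂ σ.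

ΔL : ∀ {ℓ E} → LTS ℓ E → LTS ℓ (E ⊎ E)
ΔL A = record
  { State = State A
  ; alph  = λ { (inj₁ σ) → alph A σ ; (inj₂ σ) → false }
  ; trans = λ { p nothing q → trans A p nothing q
              ; p (just (inj₁ σ)) q → trans A p (just σ) q
              ; p (just (inj₂ σ)) q → ⊥ }
  ; init  = init A
  }

ΔR : ∀ {ℓ E} → LTS ℓ E → LTS ℓ (E ⊎ E)
ΔR A = record
  { State = State A
  ; alph  = λ { (inj₁ σ) → false ; (inj₂ σ) → alph A σ }
  ; trans = λ { p nothing q → trans A p nothing q
              ; p (just (inj₁ σ)) q → ⊥
              ; p (just (inj₂ σ)) q → trans A p (just σ) q }
  ; init  = init A
  }

two : ∀ {a} {X : Set a} → X → X → Fin 2 → X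
two x y zero    = x
two x y (suc _) = y

Comp : ∀ {e} (n : ℕ) → (Fin n → FinAut e) → LTS 0ℓ (Fin e)
Comp n G = compose n (λ i → toLTS (G i))

secret∨ : ∀ {e} (n : ℕ) (G : Fin n → FinAut e) → State (Comp n G) → Bool
secret∨ n G q = not (all (λ i → not (FinAut.secret (G i) (q i))) (allFin n))

-- Two-way observer H_i = Δ(det(G_i)) ∥ Δ_R(det(G_{i,R})).
-- A state st of H_i is the pair (X^i, X^i_R) = (st zero, st (suc zero)).
TwoWay : ∀ {e} → FinAut e → LTS (lsuc 0ℓ) (Fin e ⊎ Fin e)
TwoWay G = compose 2 (two (ΔL (det (toLTS G))) (ΔR (det (toLTS (reverseAut G)))))

Obs : ∀ {e} (n : ℕ) → (Fin n → FinAut e) → LTS (lsuc 0ℓ) (Fin e ⊎ Fin e)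
Obs n G = compose n (λ i → TwoWay (G i))

PΔ : ∀ {E : Set} → List (E ⊎ E) → List (E ⊎ E)
PΔ []           = []
PΔ (inj₁ _ ∷ s) = PΔ s
PΔ (inj₂ σ ∷ s) = inj₂ σ ∷ PΔ s

module Submission where

-- Let q₀ =s⇒ m =t⇒ z be a run of G₁ ∥ ⋯ ∥ Gₙ with |t| ≤ K.  For each
-- component j feed the two-way observer Hⱼ the word Δ(s)·Δ_R(reverse t): its
-- forward estimator then holds the states of Gⱼ reachable by the projection sⱼ
-- of s from an initial state, its backward estimator holds the states from which
-- the projection tⱼ of t can be executed, and m j lies in both.  This run of
-- H = H₁ ∥ ⋯ ∥ Hₙ has |P_Δ| = |t| ≤ K, so the hypothesis says that X^j ∩ X^j_R
-- is not contained in the secret states; since the Gⱼ are finite and weak runs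
-- are decidable, we obtain a non-secret yⱼ reachable by sⱼ that can execute tⱼ.
-- Recomposing these component runs gives a run of the composition by s from an
-- initial state to the state (y₁,…,yₙ), which is non-secret for ∥_∨ and can
-- execute t.

open import Defs
open import Level using () renaming (zero to 0ℓ; suc to lsuc)
open import Data.Nat using (ℕ; zero; suc; _≤_; _<_; s≤s)
open import Data.Nat.Properties using (_≤?_; ≰⇒>; <⇒≱)
open import Data.Fin using (Fin; zero; suc; toℕ; fromℕ<)
open import Data.Fin.Properties using (_≟_; any?; pigeonhole; toℕ-fromℕ<)
open import Data.Bool using (Bool; true; false; not; if_then_else_)
open import Data.Bool.Properties using (T-≡) renaming (_≟_ to _≟ᵇ_)
open import Data.Bool.ListAction using (all; any)
open import Data.Maybe using (just; nothing)
open import Data.List using (List; []; _∷_; _++_; length; replicate; allFin; reverse; map; lookup)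
open import Data.List.Properties using (++-identityʳ; ++-assoc; unfold-reverse; reverse-involutive; length-map; length-reverse)
open import Data.List.Relation.Unary.All as All using (All; []; _∷_)
open import Data.List.Relation.Unary.All.Properties using (map⁺; ++⁺; all⁻)
open import Data.List.Relation.Unary.Any using (here; there; satisfied)
open import Data.List.Relation.Unary.Any.Properties using (any⁺; any⁻; reverse⁻)
open import Data.List.Membership.Propositional using (_∈_; _∉_; lose)
open import Data.List.Membership.Propositional.Properties using (∈-allFin; ∈-lookup)
open import Data.Product using (Σ; _×_; _,_; Σ-syntax; proj₁; proj₂)
open import Data.Sum using (_⊎_; inj₁; inj₂)
open import Data.Unit using (⊤; tt)
open import Data.Empty using (⊥-elim)
open import Function using (_∘_; Equivalence)
open import Relation.Nullary using (yes; no; Dec)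
open import Relation.Nullary.Decidable using (_×-dec_; map′)
open import Relation.Binary.PropositionalEquality
  using (_≡_; _≢_; refl; sym; cong; subst; subst₂; module ≡-Reasoning)
  renaming (trans to ≡-trans)

-- Weak runs p =s⇒ q, indexed directly by the observable string s; this is
-- the relation Weak of the statement with the τ-erasure built in.

data Run {ℓ} {E : Set} (A : LTS ℓ E) : State A → List E → State A → Set ℓ where
  done : ∀ {p} → Run A p [] p
  tau  : ∀ {p q s r} → trans A p nothing q → Run A q s r → Run A p s r
  obs  : ∀ {p σ q s r} → trans A p (just σ) q → Run A q s r → Run A p (σ ∷ s) r

module _ {ℓ} {E : Set} {A : LTS ℓ E} where

  path→run : ∀ {p t r} → Path A p t r → Run A p (erase t) r
  path→run [] = done
  path→run (_∷_ {a = nothing} x p) = tau x (path→run p)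
  path→run (_∷_ {a = just σ} x p) = obs x (path→run p)

  weak→run : ∀ {p s r} → Weak A p s r → Run A p s r
  weak→run (t , refl , p) = path→run p

  run→weak : ∀ {p s r} → Run A p s r → Weak A p s r
  run→weak done = [] , refl , []
  run→weak (tau x r) with t , eq , p ← run→weak r = nothing ∷ t , eq , x ∷ p
  run→weak (obs x r) with t , eq , p ← run→weak r = just _ ∷ t , cong (_ ∷_) eq , x ∷ p

  run-++ : ∀ {p s q t r} → Run A p s q → Run A q t r → Run A p (s ++ t) r
  run-++ done r₂ = r₂
  run-++ (tau x r₁) r₂ = tau x (run-++ r₁ r₂)
  run-++ (obs x r₁) r₂ = obs x (run-++ r₁ r₂)

  run-split : ∀ s {t p r} → Run A p (s ++ t) r → Σ[ q ∈ State A ] (Run A p s q × Run A q t r)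
  run-split [] r = _ , done , r
  run-split (σ ∷ s) (tau x r) with q , r₁ , r₂ ← run-split (σ ∷ s) r = q , tau x r₁ , r₂
  run-split (σ ∷ s) (obs x r) with q , r₁ , r₂ ← run-split s r = q , obs x r₁ , r₂

  run-first : ∀ {p σ u r} → Run A p (σ ∷ u) r →
    Σ[ a ∈ State A ] Σ[ d ∈ State A ] (Run A p [] a × trans A a (just σ) d × Run A d u r)
  run-first (tau x r) with a , d , r₁ , t , r₂ ← run-first r = a , d , tau x r₁ , t , r₂
  run-first (obs x r) = _ , _ , done , x , r

run-ΔL : ∀ {ℓ} {E : Set} {D : LTS ℓ E} {X u Y} → Run D X u Y → Run (ΔL D) X (map inj₁ u) Y
run-ΔL done = done
run-ΔL (tau x r) = tau x (run-ΔL r)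
run-ΔL (obs x r) = obs x (run-ΔL r)

run-ΔR : ∀ {ℓ} {E : Set} {D : LTS ℓ E} {X u Y} → Run D X u Y → Run (ΔR D) X (map inj₂ u) Y
run-ΔR done = done
run-ΔR (tau x r) = tau x (run-ΔR r)
run-ΔR (obs x r) = obs x (run-ΔR r)

-- The natural projection onto the events accepted by a predicate a; the run of
-- a component of a composition is driven by the projection of the joint word.
proj : ∀ {E : Set} → (E → Bool) → List E → List E
proj a [] = []
proj a (σ ∷ s) = if a σ then σ ∷ proj a s else proj a s

module _ {E : Set} (a : E → Bool) where

  proj-++ : ∀ s t → proj a (s ++ t) ≡ proj a s ++ proj a t
  proj-++ [] t = refl
  proj-++ (σ ∷ s) t with a σ
  ... | true = cong (σ ∷_) (proj-++ s t)
  ... | false = proj-++ s t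

  proj-reverse : ∀ s → proj a (reverse s) ≡ reverse (proj a s)
  proj-reverse [] = refl
  proj-reverse (σ ∷ s) = begin
      proj a (reverse (σ ∷ s))
    ≡⟨ cong (proj a) (unfold-reverse σ s) ⟩
      proj a (reverse s ++ σ ∷ [])
    ≡⟨ proj-++ (reverse s) (σ ∷ []) ⟩
      proj a (reverse s) ++ proj a (σ ∷ [])
    ≡⟨ cong (_++ proj a (σ ∷ [])) (proj-reverse s) ⟩
      reverse (proj a s) ++ proj a (σ ∷ [])
    ≡⟨ last-event ⟩
      reverse (proj a (σ ∷ s)) ∎
    where
    open ≡-Reasoning
    last-event : reverse (proj a s) ++ proj a (σ ∷ []) ≡ reverse (proj a (σ ∷ s))
    last-event with a σ
    ... | true = sym (unfold-reverse σ (proj a s))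
    ... | false = ++-identityʳ _

  proj-accepted : ∀ s → All (λ σ → a σ ≡ true) (proj a s)
  proj-accepted [] = []
  proj-accepted (σ ∷ s) with a σ in eq
  ... | true = eq ∷ proj-accepted s
  ... | false = proj-accepted s

  proj-proj : (b : E → Bool) → (∀ σ → a σ ≡ true → b σ ≡ true) →
    ∀ s → proj a (proj b s) ≡ proj a s
  proj-proj b a⊆b [] = refl
  proj-proj b a⊆b (σ ∷ s) with a σ in ea | b σ in eb
  ... | true | true rewrite ea = cong (σ ∷_) (proj-proj b a⊆b s)
  ... | true | false with () ← ≡-trans (sym eb) (a⊆b σ ea)
  ... | false | true rewrite ea = proj-proj b a⊆b s
  ... | false | false = proj-proj b a⊆b s

module _ {ℓ} {E : Set} (D : LTS ℓ E) where

  proj-ΔL : ∀ s v → proj (alph (ΔL D)) (map inj₁ s ++ map inj₂ v) ≡ map inj₁ (proj (alph D) s)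
  proj-ΔL [] [] = refl
  proj-ΔL [] (σ ∷ v) = proj-ΔL [] v
  proj-ΔL (σ ∷ s) v with alph D σ
  ... | true = cong (inj₁ σ ∷_) (proj-ΔL s v)
  ... | false = proj-ΔL s v

  proj-ΔR : ∀ s v → proj (alph (ΔR D)) (map inj₁ s ++ map inj₂ v) ≡ map inj₂ (proj (alph D) v)
  proj-ΔR (σ ∷ s) v = proj-ΔR s v
  proj-ΔR [] [] = refl
  proj-ΔR [] (σ ∷ v) with alph D σ
  ... | true = cong (inj₂ σ ∷_) (proj-ΔR [] v)
  ... | false = proj-ΔR [] v

PΔ-word : ∀ {E : Set} (s v : List E) → PΔ (map inj₁ s ++ map inj₂ v) ≡ map inj₂ v
PΔ-word [] [] = refl
PΔ-word [] (σ ∷ v) = cong (inj₂ σ ∷_) (PΔ-word [] v)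
PΔ-word (σ ∷ s) v = PΔ-word s v

All-reverse : ∀ {A : Set} {P : A → Set} {xs} → All P xs → All P (reverse xs)
All-reverse ps = All.tabulate (All.lookup ps ∘ reverse⁻)

any-allFin : ∀ {n} (p : Fin n → Bool) i → p i ≡ true → any p (allFin n) ≡ true
any-allFin p i pi = Equivalence.to T-≡ (any⁺ p (lose (∈-allFin i) (Equivalence.from T-≡ pi)))

any-witness : ∀ {n} (p : Fin n → Bool) → any p (allFin n) ≡ true → Σ[ i ∈ Fin n ] (p i ≡ true)
any-witness {n} p h with i , pi ← satisfied (any⁻ p (allFin n) (Equivalence.from T-≡ h)) =
  i , Equivalence.to T-≡ pi

all-allFin : ∀ {n} (p : Fin n → Bool) → (∀ i → p i ≡ true) → all p (allFin n) ≡ true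
all-allFin {n} p h = Equivalence.to T-≡ (all⁻ p {allFin n} (All.tabulate λ {i} _ → Equivalence.from T-≡ (h i)))

-- Since
-- states are functions, the recomposed run ends in a state that agrees
-- pointwise with the prescribed one.

module Composition {ℓ} {E : Set} {n : ℕ} (A : Fin n → LTS ℓ E) where

  C : LTS ℓ E
  C = compose n A

  St : Set ℓ
  St = (i : Fin n) → State (A i)

  project : ∀ j {p s q} → Run C p s q → Run (A j) (p j) (proj (alph (A j)) s) (q j)
  project j done = done
  project j (tau (i , step , others) r) with i ≟ j
  ... | yes refl = tau step (project j r)
  ... | no i≢j = subst (λ x → Run (A j) x _ _) (others j (i≢j ∘ sym)) (project j r)
  project j (obs {σ = σ} (_ , steps) r) with alph (A j) σ in eq
  ... | true = obs (proj₁ (steps j) eq) (project j r)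
  ... | false = subst (λ x → Run (A j) x _ _) (proj₂ (steps j) eq) (project j r)

  run-alph : ∀ {p s q} → Run C p s q → All (λ σ → alph C σ ≡ true) s
  run-alph done = []
  run-alph (tau _ r) = run-alph r
  run-alph (obs (ok , _) r) = ok ∷ run-alph r

  update : St → (j : Fin n) → State (A j) → St
  update c j v i with j ≟ i
  ... | yes refl = v
  ... | no _ = c i

  update-same : ∀ c j v → update c j v j ≡ v
  update-same c j v with j ≟ j
  ... | yes refl = refl
  ... | no j≢j = ⊥-elim (j≢j refl)

  update-other : ∀ c j v i → i ≢ j → update c j v i ≡ c i
  update-other c j v i i≢j with j ≟ i
  ... | yes refl = ⊥-elim (i≢j refl)
  ... | no _ = refl

  lift-tau : ∀ (c : St) j {w v} → w ≡ c j → Run (A j) w [] v →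
    Σ[ c' ∈ St ] ((c' j ≡ v) × (∀ k → k ≢ j → c' k ≡ c k) × Run C c [] c')
  lift-tau c j eq done = c , sym eq , (λ _ _ → refl) , done
  lift-tau c j eq (tau {q = w₁} x r)
    with c' , at-j , elsewhere , r' ← lift-tau (update c j w₁) j (sym (update-same c j w₁)) r =
    c' , at-j , (λ k k≢j → ≡-trans (elsewhere k k≢j) (update-other c j w₁ k k≢j)) ,
    tau (j , subst₂ (λ a b → trans (A j) a nothing b) eq (sym (update-same c j w₁)) x ,
             λ k k≢j → update-other c j w₁ k k≢j) r'

  tau-components : ∀ (L : List (Fin n)) (c y : St) → (∀ j → Run (A j) (c j) [] (y j)) →
    (∀ j → j ∉ L → c j ≡ y j) → Σ[ c' ∈ St ] ((∀ j → c' j ≡ y j) × Run C c [] c')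
  tau-components [] c y R outside = c , (λ j → outside j (λ ())) , done
  tau-components (h ∷ L) c y R outside with lift-tau c h refl (R h)
  ... | c₁ , at-h , elsewhere , r₁ with tau-components L c₁ y R₁ outside₁
    where
    R₁ : ∀ j → Run (A j) (c₁ j) [] (y j)
    R₁ j with j ≟ h
    ... | yes refl = subst (λ x → Run (A j) x [] (y j)) (sym at-h) done
    ... | no j≢h = subst (λ x → Run (A j) x [] (y j)) (sym (elsewhere j j≢h)) (R j)
    outside₁ : ∀ j → j ∉ L → c₁ j ≡ y j
    outside₁ j j∉L with j ≟ h
    ... | yes refl = at-h
    ... | no j≢h = ≡-trans (elsewhere j j≢h) (outside j λ { (here e) → j≢h e ; (there m) → j∉L m })
  ... | c' , eq , r₂ = c' , eq , run-++ r₁ r₂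

  tau-all : ∀ (c y : St) → (∀ j → Run (A j) (c j) [] (y j)) →
    Σ[ c' ∈ St ] ((∀ j → c' j ≡ y j) × Run C c [] c')
  tau-all c y R = tau-components (allFin n) c y R (λ j j∉ → ⊥-elim (j∉ (∈-allFin j)))

  StepOrStay : (j : Fin n) → E → State (A j) → State (A j) → Set ℓ
  StepOrStay j σ a d = (alph (A j) σ ≡ true → trans (A j) a (just σ) d) × (alph (A j) σ ≡ false → d ≡ a)

  first-event : ∀ j σ u {x y} → Run (A j) x (proj (alph (A j)) (σ ∷ u)) y →
    Σ[ a ∈ State (A j) ] Σ[ d ∈ State (A j) ]
      (Run (A j) x [] a × StepOrStay j σ a d × Run (A j) d (proj (alph (A j)) u) y)
  first-event j σ u r with alph (A j) σ
  ... | false = _ , _ , done , ((λ ()) , (λ _ → refl)) , r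
  ... | true with a , d , r₁ , step , r₂ ← run-first r = a , d , r₁ , ((λ _ → step) , (λ ())) , r₂

  -- Induction on s: for each event, first all components move silently to the
  -- state before it, then they take it jointly.
  recompose : ∀ s (c y : St) → All (λ σ → alph C σ ≡ true) s →
    (∀ j → Run (A j) (c j) (proj (alph (A j)) s) (y j)) →
    Σ[ c' ∈ St ] ((∀ j → c' j ≡ y j) × Run C c s c')
  recompose [] c y _ R = tau-all c y R
  recompose (σ ∷ u) c y (ok ∷ oks) R = continue (tau-all c before (λ j → proj₁ (proj₂ (proj₂ (split j)))))
    where
    split : ∀ j → Σ[ a ∈ State (A j) ] Σ[ d ∈ State (A j) ]
      (Run (A j) (c j) [] a × StepOrStay j σ a d × Run (A j) d (proj (alph (A j)) u) (y j))
    split j = first-event j σ u (R j)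
    before after : St
    before j = proj₁ (split j)
    after j = proj₁ (proj₂ (split j))
    continue : Σ[ c₁ ∈ St ] ((∀ j → c₁ j ≡ before j) × Run C c [] c₁) →
      Σ[ c' ∈ St ] ((∀ j → c' j ≡ y j) × Run C c (σ ∷ u) c')
    continue (c₁ , c₁≡before , r₁)
      with c' , eq , r₂ ← recompose u after y oks (λ j → proj₂ (proj₂ (proj₂ (proj₂ (split j))))) =
      c' , eq , run-++ r₁ (obs (ok , joint) r₂)
      where
      joint : ∀ i → StepOrStay i σ (c₁ i) (after i)
      joint i with step , stay ← proj₁ (proj₂ (proj₂ (proj₂ (split i)))) =
        (λ h → subst (λ x → trans (A i) x (just σ) (after i)) (sym (c₁≡before i)) (step h)) ,
        (λ h → ≡-trans (stay h) (sym (c₁≡before i)))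

-- Reversal.  `reversed A I` has the transitions of A reversed and initial
-- states I; both G_R and G itself (as the reversal of G_R) are of this form, so
-- runs can be read backwards in either direction.

reversed : ∀ {ℓ} {E : Set} (A : LTS ℓ E) → (State A → Set ℓ) → LTS ℓ E
reversed A I = record A { trans = λ p a q → trans A q a p ; init = I }

module _ {ℓ} {E : Set} {A : LTS ℓ E} {I : State A → Set ℓ} where

  run-reverse-acc : ∀ {x u q v z} → Run A x u q → Run (reversed A I) x v z →
    Run (reversed A I) q (reverse u ++ v) z
  run-reverse-acc done r' = r'
  run-reverse-acc (tau t r) r' = run-reverse-acc r (tau t r')
  run-reverse-acc {u = σ ∷ u} {v = v} (obs t r) r' =
    subst (λ w → Run (reversed A I) _ w _) shift (run-reverse-acc r (obs t r'))
    where
    shift : reverse u ++ σ ∷ v ≡ reverse (σ ∷ u) ++ v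
    shift = ≡-trans (sym (++-assoc (reverse u) (σ ∷ []) v)) (cong (_++ v) (sym (unfold-reverse σ u)))

  run-reverse : ∀ {x u q} → Run A x u q → Run (reversed A I) q (reverse u) x
  run-reverse {u = u} r =
    subst (λ w → Run (reversed A I) _ w _) (++-identityʳ (reverse u)) (run-reverse-acc r done)

-- The current-state estimator of a finite automaton G: det(G) started in a
-- τ-closed set X and fed u is in the set `estimate X u`, which contains exactly
-- the states reachable from X by u.

module Estimator {e : ℕ} (G : FinAut e) where

  A : LTS 0ℓ (Fin e)
  A = toLTS G

  Q : Set
  Q = Fin (FinAut.nQ G)

  τ-snoc : ∀ k {x y y'} → Path A x (replicate k nothing) y → trans A y nothing y' →
    Path A x (replicate (suc k) nothing) y'
  τ-snoc zero [] t = t ∷ []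
  τ-snoc (suc k) (x ∷ p) t = x ∷ τ-snoc k p t

  τ-path→run : ∀ k {x y} → Path A x (replicate k nothing) y → Run A x [] y
  τ-path→run zero [] = done
  τ-path→run (suc k) (x ∷ p) = tau x (τ-path→run k p)

  UR-sound : ∀ {B y} → UR A B y → Σ[ x ∈ Q ] (B x × Run A x [] y)
  UR-sound (x , bx , k , p) = x , bx , τ-path→run k p

  TauClosed : (Q → Set) → Set
  TauClosed X = ∀ x y → X x → trans A x nothing y → X y

  UR-closed : ∀ B → TauClosed (UR A B)
  UR-closed B x y (z , bz , k , p) t = z , bz , suc k , τ-snoc k p t

  post-closed : ∀ X σ → TauClosed (post A X σ)
  post-closed X σ x y (z , xz , y' , t , ur) t₂ = z , xz , y' , t , UR-closed _ x y ur t₂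

  estimate : (Q → Set) → List (Fin e) → Q → Set
  estimate X [] = X
  estimate X (σ ∷ u) = estimate (post A X σ) u

  estimate-sound : ∀ X u q → estimate X u q → Σ[ x ∈ Q ] (X x × Run A x u q)
  estimate-sound X [] q h = q , h , done
  estimate-sound X (σ ∷ u) q h
    with _ , (x , xx , _ , t , (_ , refl , k , p)) , r ← estimate-sound (post A X σ) u q h =
    x , xx , obs t (run-++ (τ-path→run k p) r)

  -- A witnessing run keeps every intermediate estimate nonempty, so det(G) runs.
  estimate-complete : ∀ X u x q → TauClosed X → X x → Run A x u q →
    Run (det A) X u (estimate X u) × estimate X u q
  estimate-complete X [] x q closed xx done = done , xx
  estimate-complete X u x q closed xx (tau {q = x₁} t r) =
    estimate-complete X u x₁ q closed (closed x x₁ xx t) r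
  estimate-complete X (σ ∷ u) x q closed xx (obs {q = y} t r) =
    let det-run , q∈ = estimate-complete (post A X σ) u y q (post-closed X σ) y∈post r
    in obs (FinAut.trans-alph G x σ y t , refl , y , y∈post) det-run , q∈
    where
    y∈post : post A X σ y
    y∈post = x , xx , y , t , (y , refl , 0 , [])

-- The only unbounded part is
-- τ-reachability: cutting out cycles turns a τ-run into a walk through
-- distinct states, which by the pigeonhole principle has fewer than |Q| steps.

module Decide {e : ℕ} (G : FinAut e) where

  open Estimator G using (A; Q)
  N : ℕ
  N = FinAut.nQ G

  open import Data.List.Membership.DecPropositional (_≟_ {n = N}) using (_∈?_)

  τ-step : Q → Q → Set
  τ-step x y = FinAut.trans G x nothing y ≡ true

  τ-steps : Q → ℕ → Q → Set
  τ-steps p zero q = p ≡ q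
  τ-steps p (suc k) q = Σ[ r ∈ Q ] (τ-step p r × τ-steps r k q)

  τ-steps? : ∀ p k q → Dec (τ-steps p k q)
  τ-steps? p zero q = p ≟ q
  τ-steps? p (suc k) q = any? (λ r → (FinAut.trans G p nothing r ≟ᵇ true) ×-dec τ-steps? r k q)

  τ-steps→run : ∀ p k q → τ-steps p k q → Run A p [] q
  τ-steps→run p zero q refl = done
  τ-steps→run p (suc k) q (r , t , rest) = tau t (τ-steps→run r k q rest)

  data Walk (x : Q) : List Q → Q → Set where
    stop : Walk x [] x
    step : ∀ {y vs z} → τ-step x y → Walk y vs z → Walk x (y ∷ vs) z

  Distinct : List Q → Set
  Distinct [] = ⊤
  Distinct (x ∷ xs) = (x ∉ xs) × Distinct xs

  walk→τ-steps : ∀ {x vs z} → Walk x vs z → τ-steps x (length vs) z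
  walk→τ-steps stop = refl
  walk→τ-steps (step t w) = _ , t , walk→τ-steps w

  shortcut : ∀ {x y vs z} → Walk y vs z → Distinct (y ∷ vs) → x ∈ (y ∷ vs) →
    Σ[ vs' ∈ List Q ] (Distinct (x ∷ vs') × Walk x vs' z)
  shortcut w d (here refl) = _ , d , w
  shortcut stop d (there ())
  shortcut (step t w) (_ , d) (there m) = shortcut w d m

  run→distinct-walk : ∀ {x z} → Run A x [] z → Σ[ vs ∈ List Q ] (Distinct (x ∷ vs) × Walk x vs z)
  run→distinct-walk done = [] , ((λ ()) , tt) , stop
  run→distinct-walk {x} (tau {q = y} t r) with run→distinct-walk r
  ... | vs , d , w with x ∈? (y ∷ vs)
  ... | yes x∈ = shortcut w d x∈
  ... | no x∉ = y ∷ vs , (x∉ , d) , step t w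

  distinct-lookup : ∀ xs → Distinct xs → ∀ (i j : Fin (length xs)) → toℕ i < toℕ j →
    lookup xs i ≢ lookup xs j
  distinct-lookup (x ∷ xs) (x∉ , d) zero (suc j) _ eq = x∉ (subst (_∈ xs) (sym eq) (∈-lookup j))
  distinct-lookup (x ∷ xs) (x∉ , d) (suc i) (suc j) (s≤s i<j) eq = distinct-lookup xs d i j i<j eq

  distinct-length : ∀ xs → Distinct xs → length xs ≤ N
  distinct-length xs d with length xs ≤? N
  ... | yes ≤N = ≤N
  ... | no ≰N with i , j , i<j , eq ← pigeonhole (≰⇒> ≰N) (lookup xs) =
    ⊥-elim (distinct-lookup xs d i j i<j eq)

  run→bounded-τ-steps : ∀ {p q} → Run A p [] q → Σ[ k ∈ Fin N ] τ-steps p (toℕ k) q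
  run→bounded-τ-steps r with vs , d , w ← run→distinct-walk r =
    fromℕ< (distinct-length _ d) ,
    subst (λ k → τ-steps _ k _) (sym (toℕ-fromℕ< (distinct-length _ d))) (walk→τ-steps w)

  run? : ∀ p u q → Dec (Run A p u q)
  run? p [] q = map′ (λ (k , steps) → τ-steps→run p (toℕ k) q steps) run→bounded-τ-steps
                     (any? (λ k → τ-steps? p (toℕ k) q))
  run? p (σ ∷ u) q = map′ join run-first
    (any? λ a → any? λ d → run? p [] a ×-dec ((FinAut.trans G a (just σ) d ≟ᵇ true) ×-dec run? d u q))
    where
    join : Σ[ a ∈ Q ] Σ[ d ∈ Q ] (Run A p [] a × (trans A a (just σ) d × Run A d u q)) → Run A p (σ ∷ u) q
    join (a , d , r₁ , t , r₂) = run-++ r₁ (obs t r₂)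

module Observer {e : ℕ} (n : ℕ) (G : Fin n → FinAut e) where

  A Aᴿ : Fin n → LTS 0ℓ (Fin e)
  A j = toLTS (G j)
  Aᴿ j = toLTS (reverseAut (G j))

  a : Fin n → Fin e → Bool
  a j = FinAut.alph (G j)

  C : LTS 0ℓ (Fin e)
  C = Comp n G

  open Composition A using (project; run-alph)

  X₀ X₀ᴿ : (j : Fin n) → Fin (FinAut.nQ (G j)) → Set
  X₀ j = UR (A j) (init (A j))
  X₀ᴿ j = UR (Aᴿ j) (init (Aᴿ j))

  forward backward : (j : Fin n) → List (Fin e) → Fin (FinAut.nQ (G j)) → Set
  forward j s = Estimator.estimate (G j) (X₀ j) (proj (a j) s)
  backward j v = Estimator.estimate (reverseAut (G j)) (X₀ᴿ j) (proj (a j) v)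

  forward-complete : ∀ {q₀ s m} → init C q₀ → Run C q₀ s m → ∀ j →
    Run (det (A j)) (X₀ j) (proj (a j) s) (forward j s) × forward j s (m j)
  forward-complete {q₀} {m = m} init₀ r j =
    Estimator.estimate-complete (G j) (X₀ j) _ (q₀ j) (m j)
      (Estimator.UR-closed (G j) _) (q₀ j , init₀ j , 0 , []) (project j r)

  backward-complete : ∀ {m t z} → Run C m t z → ∀ j →
    Run (det (Aᴿ j)) (X₀ᴿ j) (proj (a j) (reverse t)) (backward j (reverse t)) × backward j (reverse t) (m j)
  backward-complete {m} {t} {z} r j =
    Estimator.estimate-complete (reverseAut (G j)) (X₀ᴿ j) _ (z j) (m j)
      (Estimator.UR-closed (reverseAut (G j)) _) (z j , refl , 0 , [])
      (subst (λ u → Run (Aᴿ j) (z j) u (m j)) (sym (proj-reverse (a j) t)) (run-reverse (project j r)))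

  forward-sound : ∀ j s q → forward j s q →
    Σ[ h₀ ∈ Fin (FinAut.nQ (G j)) ] (FinAut.init (G j) h₀ ≡ true × Run (A j) h₀ (proj (a j) s) q)
  forward-sound j s q q∈
    with x , x∈ , r ← Estimator.estimate-sound (G j) (X₀ j) (proj (a j) s) q q∈
    with h₀ , init-h₀ , τ-run ← Estimator.UR-sound (G j) x∈ = h₀ , init-h₀ , run-++ τ-run r

  backward-sound : ∀ j t q → backward j (reverse t) q → Σ[ z ∈ Fin (FinAut.nQ (G j)) ] Run (A j) q (proj (a j) t) z
  backward-sound j t q q∈
    with z , _ , r ← Estimator.estimate-sound (reverseAut (G j)) (X₀ᴿ j) (proj (a j) (reverse t)) q q∈ =
    z , subst (λ u → Run (A j) q u z) unreverse (run-reverse (subst (λ u → Run (Aᴿ j) z u q) (proj-reverse (a j) t) r))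
    where
    unreverse : reverse (reverse (proj (a j) t)) ≡ proj (a j) t
    unreverse = reverse-involutive (proj (a j) t)

  word : List (Fin e) → List (Fin e) → List (Fin e ⊎ Fin e)
  word s t = map inj₁ s ++ map inj₂ (reverse t)

  L R : Fin n → LTS (lsuc 0ℓ) (Fin e ⊎ Fin e)
  L j = ΔL (det (A j))
  R j = ΔR (det (Aᴿ j))

  H : Fin n → LTS (lsuc 0ℓ) (Fin e ⊎ Fin e)
  H j = TwoWay (G j)

  pair : ∀ j → State (L j) → State (R j) → State (H j)
  pair j X Y zero = X
  pair j X Y (suc zero) = Y

  start : State (Obs n G)
  start j = pair j (X₀ j) (X₀ᴿ j)

  start-init : init (Obs n G) start
  start-init j zero = refl
  start-init j (suc zero) = refl

  left-view : ∀ j s t → proj (alph (L j)) (proj (alph (H j)) (word s t)) ≡ map inj₁ (proj (a j) s)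
  left-view j s t = ≡-trans (proj-proj (alph (L j)) (alph (H j)) (λ σ h → any-allFin (λ k → alph (two (L j) (R j) k) σ) zero h) (word s t))
                            (proj-ΔL (det (A j)) s (reverse t))

  right-view : ∀ j s t → proj (alph (R j)) (proj (alph (H j)) (word s t)) ≡ map inj₂ (proj (a j) (reverse t))
  right-view j s t = ≡-trans (proj-proj (alph (R j)) (alph (H j)) (λ σ h → any-allFin (λ k → alph (two (L j) (R j) k) σ) (suc zero) h) (word s t))
                             (proj-ΔR (det (Aᴿ j)) s (reverse t))

  component-run : ∀ {q₀ s m t z} → init C q₀ → Run C q₀ s m → Run C m t z → ∀ j →
    Σ[ h ∈ State (H j) ] ((∀ k → h k ≡ pair j (forward j s) (backward j (reverse t)) k) ×
                         Run (H j) (start j) (proj (alph (H j)) (word s t)) h)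
  component-run {s = s} {t = t} init₀ r₁ r₂ j =
    Composition.recompose (two (L j) (R j)) (proj (alph (H j)) (word s t)) (start j) _
      (proj-accepted (alph (H j)) (word s t)) halves
    where
    halves : ∀ k → Run (two (L j) (R j) k) (start j k)
                       (proj (alph (two (L j) (R j) k)) (proj (alph (H j)) (word s t)))
                       (pair j (forward j s) (backward j (reverse t)) k)
    halves zero = subst (λ u → Run (L j) (X₀ j) u (forward j s)) (sym (left-view j s t))
                        (run-ΔL (proj₁ (forward-complete init₀ r₁ j)))
    halves (suc zero) = subst (λ u → Run (R j) (X₀ᴿ j) u (backward j (reverse t))) (sym (right-view j s t))
                              (run-ΔR (proj₁ (backward-complete r₂ j)))

  alph-Δ : ∀ σ → alph C σ ≡ true → alph (Obs n G) (inj₁ σ) ≡ true × alph (Obs n G) (inj₂ σ) ≡ true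
  alph-Δ σ σ∈ with i , σ∈i ← any-witness (λ i → a i σ) σ∈ =
    in-H inj₁ zero σ∈i , in-H inj₂ (suc zero) σ∈i
    where
    in-H : (rename : Fin e → Fin e ⊎ Fin e) → (k : Fin 2) → alph (two (L i) (R i) k) (rename σ) ≡ true →
      alph (Obs n G) (rename σ) ≡ true
    in-H rename k h = any-allFin (λ c → alph (H c) (rename σ)) i
                        (any-allFin (λ half → alph (two (L i) (R i) half) (rename σ)) k h)

  observer-run : ∀ {q₀ s m t z} → init C q₀ → Run C q₀ s m → Run C m t z →
    Σ[ st ∈ State (Obs n G) ] (InitRun (Obs n G) (word s t) st ×
      (∀ j → st j zero ≡ forward j s × st j (suc zero) ≡ backward j (reverse t)))
  observer-run {s = s} {t = t} init₀ r₁ r₂ =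
    st , (start , start-init , run→weak run) , λ j → halves j zero , halves j (suc zero)
    where
    components : ∀ j → Σ[ h ∈ State (H j) ] ((∀ k → h k ≡ pair j (forward j s) (backward j (reverse t)) k) ×
                                            Run (H j) (start j) (proj (alph (H j)) (word s t)) h)
    components j = component-run init₀ r₁ r₂ j
    word-alph : All (λ σ → alph (Obs n G) σ ≡ true) (word s t)
    word-alph = ++⁺ (map⁺ (All.map (λ {σ} → proj₁ ∘ alph-Δ σ) (run-alph r₁)))
                    (map⁺ (All.map (λ {σ} → proj₂ ∘ alph-Δ σ) (All-reverse (run-alph r₂))))
    recomposed : Σ[ st ∈ State (Obs n G) ] ((∀ j → st j ≡ proj₁ (components j)) × Run (Obs n G) start (word s t) st)
    recomposed = Composition.recompose H (word s t) start (λ j → proj₁ (components j))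
                   word-alph (λ j → proj₂ (proj₂ (components j)))
    st : State (Obs n G)
    st = proj₁ recomposed
    run : Run (Obs n G) start (word s t) st
    run = proj₂ (proj₂ recomposed)
    halves : ∀ j k → st j k ≡ pair j (forward j s) (backward j (reverse t)) k
    halves j k = ≡-trans (cong (λ h → h k) (proj₁ (proj₂ recomposed) j)) (proj₁ (proj₂ (components j)) k)

module Opacity {e : ℕ} (n : ℕ) (G : Fin n → FinAut e) where

  open Observer n G
  open Composition A using (run-alph; recompose)

  RevealedLate : ℕ → Set₁
  RevealedLate K = ∀ (s : List (Fin e ⊎ Fin e)) (st : State (Obs n G)) →
    InitRun (Obs n G) s st →
    (Σ[ i ∈ Fin n ]
      ((∀ q → st i zero q → st i (suc zero) q → FinAut.secret (G i) q ≡ true)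
       × (Σ[ q ∈ Fin (FinAut.nQ (G i)) ] (st i zero q × st i (suc zero) q)))) →
    K < length (PΔ s)

  Witness : List (Fin e) → List (Fin e) → (j : Fin n) → Set
  Witness s t j = Σ[ y ∈ Fin (FinAut.nQ (G j)) ]
    ((Σ[ h₀ ∈ Fin (FinAut.nQ (G j)) ] (FinAut.init (G j) h₀ ≡ true × Run (A j) h₀ (proj (a j) s) y)) ×
     (Σ[ z ∈ Fin (FinAut.nQ (G j)) ] Run (A j) y (proj (a j) t) z) ×
     FinAut.secret (G j) y ≡ false)

  witness? : ∀ s t j → Dec (Witness s t j)
  witness? s t j = any? λ y →
    (any? λ h₀ → (FinAut.init (G j) h₀ ≟ᵇ true) ×-dec run? h₀ (proj (a j) s) y) ×-dec
    (any? λ z → run? y (proj (a j) t) z) ×-dec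
    (FinAut.secret (G j) y ≟ᵇ false)
    where open Decide (G j) using (run?)

  length-PΔ-word : ∀ s t → length (PΔ (word s t)) ≡ length t
  length-PΔ-word s t = begin
    length (PΔ (word s t))        ≡⟨ cong length (PΔ-word s (reverse t)) ⟩
    length (map inj₂ (reverse t)) ≡⟨ length-map inj₂ (reverse t) ⟩
    length (reverse t)            ≡⟨ length-reverse t ⟩
    length t                      ∎
    where open ≡-Reasoning

  -- Each component has a witness: otherwise X^j ∩ X^j_R, which contains m j,
  -- consists of secret states after observing only |t| ≤ K reversed events.
  witness : ∀ {K q₀ s m t z} → RevealedLate K → init C q₀ → Run C q₀ s m → Run C m t z →
    length t ≤ K → ∀ j → Witness s t j
  witness {K} {s = s} {m} {t} late init₀ r₁ r₂ |t|≤K j with witness? s t j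
  ... | yes w = w
  ... | no no-witness = ⊥-elim (<⇒≱ (subst (K <_) (length-PΔ-word s t) revealed) |t|≤K)
    where
    observed : Σ[ st ∈ State (Obs n G) ] (InitRun (Obs n G) (word s t) st ×
                 (∀ j → st j zero ≡ forward j s × st j (suc zero) ≡ backward j (reverse t)))
    observed = observer-run init₀ r₁ r₂
    st : State (Obs n G)
    st = proj₁ observed
    st-fwd : st j zero ≡ forward j s
    st-fwd = proj₁ (proj₂ (proj₂ observed) j)
    st-bwd : st j (suc zero) ≡ backward j (reverse t)
    st-bwd = proj₂ (proj₂ (proj₂ observed) j)
    only-secret : ∀ q → st j zero q → st j (suc zero) q → FinAut.secret (G j) q ≡ true
    only-secret q q∈ q∈ᴿ with FinAut.secret (G j) q in non-secret
    ... | true = refl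
    ... | false = ⊥-elim (no-witness (q ,
      forward-sound j s q (subst (λ X → X q) st-fwd q∈) ,
      backward-sound j t q (subst (λ X → X q) st-bwd q∈ᴿ) , non-secret))
    m-shared : st j zero (m j) × st j (suc zero) (m j)
    m-shared = subst (λ X → X (m j)) (sym st-fwd) (proj₂ (forward-complete init₀ r₁ j)) ,
               subst (λ X → X (m j)) (sym st-bwd) (proj₂ (backward-complete r₂ j))
    revealed : K < length (PΔ (word s t))
    revealed = late (word s t) st (proj₁ (proj₂ observed)) (j , only-secret , m j , m-shared)

  opaque-from-witnesses : ∀ {s t} → All (λ σ → alph C σ ≡ true) s → All (λ σ → alph C σ ≡ true) t →
    (∀ j → Witness s t j) →
    Σ[ q₀' ∈ State C ] (init C q₀' ×
      Σ[ y ∈ State C ] (secret∨ n G y ≡ false × Weak C q₀' s y × Can C y t))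
  opaque-from-witnesses {s} {t} s-alph t-alph w =
    x , (λ j → proj₁ (proj₂ (reached j))) ,
    y' , non-secret , run→weak run-s , proj₁ after-t , run→weak (proj₂ (proj₂ after-t))
    where
    y : State C
    y j = proj₁ (w j)
    reached : ∀ j → Σ[ h₀ ∈ Fin (FinAut.nQ (G j)) ] (FinAut.init (G j) h₀ ≡ true × Run (A j) h₀ (proj (a j) s) (y j))
    reached j = proj₁ (proj₂ (w j))
    continues : ∀ j → Σ[ z ∈ Fin (FinAut.nQ (G j)) ] Run (A j) (y j) (proj (a j) t) z
    continues j = proj₁ (proj₂ (proj₂ (w j)))
    y-public : ∀ j → FinAut.secret (G j) (y j) ≡ false
    y-public j = proj₂ (proj₂ (proj₂ (w j)))
    x z : State C
    x j = proj₁ (reached j)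
    z j = proj₁ (continues j)
    after-s : Σ[ y' ∈ State C ] ((∀ j → y' j ≡ y j) × Run C x s y')
    after-s = recompose s x y s-alph (λ j → proj₂ (proj₂ (reached j)))
    y' : State C
    y' = proj₁ after-s
    y'≡y : ∀ j → y' j ≡ y j
    y'≡y = proj₁ (proj₂ after-s)
    run-s : Run C x s y'
    run-s = proj₂ (proj₂ after-s)
    after-t : Σ[ z' ∈ State C ] ((∀ j → z' j ≡ z j) × Run C y' t z')
    after-t = recompose t y' z t-alph λ j →
      subst (λ v → Run (A j) v (proj (a j) t) (z j)) (sym (y'≡y j)) (proj₂ (continues j))
    non-secret : secret∨ n G y' ≡ false
    non-secret = cong not (all-allFin (λ i → not (FinAut.secret (G i) (y' i))) λ i →
      cong not (≡-trans (cong (FinAut.secret (G i)) (y'≡y i)) (y-public i)))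

theorem8 : ∀ {e : ℕ} (n : ℕ) → 1 ≤ n → (G : Fin n → FinAut e) (K : ℕ) →
    (∀ (s : List (Fin e ⊎ Fin e)) (st : State (Obs n G)) →
      InitRun (Obs n G) s st →
      (Σ[ i ∈ Fin n ]
        ((∀ q → st i zero q → st i (suc zero) q → FinAut.secret (G i) q ≡ true)
         × (Σ[ q ∈ Fin (FinAut.nQ (G i)) ] (st i zero q × st i (suc zero) q)))) →
      K < length (PΔ s)) →
    KStepOpaque (Comp n G) (secret∨ n G) K
theorem8 n _ G K late q₀ init₀ s t (_ , run) _ |t|≤K
  with m , r₁ , r₂ ← run-split s (weak→run run) =
  opaque-from-witnesses (run-alph r₁) (run-alph r₂) (witness late init₀ r₁ r₂ |t|≤K)
  where
  open Opacity n G
  open Composition (λ j → toLTS (G j)) using (run-alph)
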